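{- Let $t\ge2$, $k_1\ge k_2\ge\cdots\ge k_t$ be positive integers and $n\ge k_1+k_2$. Let $\mathcal{A}_1\subset\binom{[n]}{k_1},\dots,\mathcal{A}_t\subset\binom{[n]}{k_t}$ be non-empty pairwise cross-intersecting families such that each $\mathcal{A}_j$ is L-initial. Let $i\in[t]$ be an index with $|\mathcal{A}_i|\ge\binom{n-1}{k_i-1}$, and let $m=\min_{j\ne i}k_j$. Then $$|\mathcal{A}_i|\le\binom{n-1}{k_i-1}+\binom{n-2}{k_i-1}+\cdots+\binom{n-m}{k_i-1}.$$
   Context: Families $\mathcal{A},\mathcal{B}$ are cross-intersecting if $A\cap B\ne\emptyset$ for all $A\in\mathcal{A},B\in\mathcal{B}$; pairwise cross-intersecting means every two of the families are cross-intersecting, and non-empty means each family is non-empty. Lexicographic order on finite subsets of positive integers: $A\prec B$ if either $A\supseteq B$ or $\min(A\setminus B)<\min(B\setminus A)$. A family $\mathcal{F}\subset\binom{[n]}{k}$ is L-initial if it consists of the first $|\mathcal{F}|$ sets of $\binom{[n]}{k}$ in this order. -}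

module Defs where

open import Data.Nat using (ℕ; zero; suc; _+_; _∸_; _<_; _≤_)
open import Data.Nat.Combinatorics using (_C_)
open import Data.Fin using (Fin; toℕ)
open import Data.Fin.Subset using (Subset; _∈_; _∉_; _⊇_; _─_; _∩_; ∣_∣; Nonempty)
open import Data.List using (List; length)
open import Data.List.Membership.Propositional using () renaming (_∈_ to _∈ₗ_)
open import Data.List.Relation.Unary.Unique.Propositional using (Unique)
open import Data.List.Relation.Unary.All using (All)
open import Data.Product using (_×_; ∃; ∃₂)
open import Relation.Binary.PropositionalEquality using (_≡_)
open import Data.Sum using (_⊎_)

-- A subset of [n] is a Subset n; element (toℕ x) corresponds to x+1 ∈ [n].
-- A family of subsets is a duplicate-free list; its size is the list length.

record Family (n : ℕ) : Set where
  constructor family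
  field
    members : List (Subset n)
    unique  : Unique members
open Family public

∣_∣ᶠ : ∀ {n} → Family n → ℕ
∣ F ∣ᶠ = length (members F)

_∈ᶠ_ : ∀ {n} → Subset n → Family n → Set
A ∈ᶠ F = A ∈ₗ members F

Uniform : ∀ {n} → ℕ → Family n → Set
Uniform k F = All (λ A → ∣ A ∣ ≡ k) (members F)

NonemptyFamily : ∀ {n} → Family n → Set
NonemptyFamily F = ∃ λ A → A ∈ᶠ F

CrossIntersecting : ∀ {n} → Family n → Family n → Set
CrossIntersecting F G = ∀ A B → A ∈ᶠ F → B ∈ᶠ G → Nonempty (A ∩ B)

IsMin : ∀ {n} → Fin n → Subset n → Set
IsMin x S = x ∈ S × (∀ y → y ∈ S → toℕ x ≤ toℕ y)

_≺_ : ∀ {n} → Subset n → Subset n → Set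
A ≺ B = A ⊇ B ⊎ ∃₂ λ a b → IsMin a (A ─ B) × IsMin b (B ─ A) × toℕ a < toℕ b

LInitial : ∀ {n} → ℕ → Family n → Set
LInitial {n} k F = Uniform k F × (∀ A B → A ∈ᶠ F → ∣ B ∣ ≡ k → B ≺ A → B ∈ᶠ F)

binomSum : ℕ → ℕ → ℕ → ℕ
binomSum n k zero = 0
binomSum n k (suc m) = binomSum n k m + (n ∸ suc m) C k

{-# OPTIONS --safe #-}
module Submission where

-- Pick j ≠ i with k j = m. Being L-initial and non-empty, A j contains the ≺-least
-- m-set [m], so every member of A i meets [m]. Splitting on the first point of [n],
-- the k-sets meeting [m] are the C(n-1,k-1) sets containing 1 together with the
-- k-subsets of {2,…,n} meeting {2,…,m}; induction on m gives the bound
-- C(n-1,k-1) + … + C(n-m,k-1).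

open import Defs
open import Data.Bool using (Bool; true; false)
open import Data.Bool.Properties using (_≟_)
open import Data.Empty using (⊥-elim)
open import Data.Fin using (Fin; zero; suc; toℕ; fromℕ<)
open import Data.Fin renaming (_≤_ to _≤ꟳ_) using ()
open import Data.Fin.Subset using (Subset; _∈_; _∉_; _∩_; _─_; _⊆_; ∣_∣; Nonempty)
open import Data.Fin.Subset.Properties
  using (_∈?_; ∣p∣≤n; p⊂q⇒∣p∣<∣q∣; x∈p∧x∉q⇒x∈p─q; p─q⊆p; p∩q⊆q)
open import Data.List using (List; []; _∷_; length)
open import Data.List.Relation.Unary.All as All using (All; []; _∷_)
open import Data.List.Relation.Unary.AllPairs using ([]; _∷_)
open import Data.List.Relation.Unary.Unique.Propositional using (Unique)
open import Data.Nat using (ℕ; zero; suc; _+_; _∸_; _≤_; _≥_; _<_; z≤n; s≤s)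
open import Data.Nat.Combinatorics using (_C_; nCk≡nC[n∸k]; nCn≡1; nCk+nC[k+1]≡[n+1]C[k+1])
open import Data.Nat.Properties
  using (≤-refl; ≤-reflexive; ≤-trans; n≮0; <-irrefl; <-≤-trans; ≮⇒≥; +-suc; +-comm; +-assoc; +-mono-≤; suc-injective; module ≤-Reasoning)
open import Data.Product using (_×_; _,_; ∃; proj₁)
open import Data.Sum using (_⊎_; inj₁; inj₂)
open import Data.Vec using ([]; _∷_; here; there)
open import Function using (_∘_)
open import Relation.Nullary using (¬_; yes; no)
open import Relation.Binary.PropositionalEquality

All-unsatisfiable⇒[] : ∀ {A : Set} {P : A → Set} {xs : List A} →
  (∀ {x} → ¬ P x) → All P xs → xs ≡ []
All-unsatisfiable⇒[] ¬P [] = refl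
All-unsatisfiable⇒[] ¬P (px ∷ _) = ⊥-elim (¬P px)

nC0≡1 : ∀ n → n C 0 ≡ 1
nC0≡1 n = trans (nCk≡nC[n∸k] {n = n} z≤n) (nCn≡1 n)

binomSum-suc : ∀ n r m → binomSum (suc n) r (suc m) ≡ n C r + binomSum n r m
binomSum-suc n r zero = +-comm 0 (n C r)
binomSum-suc n r (suc m) =
  trans (cong (_+ (n ∸ suc m) C r) (binomSum-suc n r m)) (+-assoc (n C r) _ _)

module _ {n : ℕ} where

  tailsWith : Bool → List (Subset (suc n)) → List (Subset n)
  tailsWith b [] = []
  tailsWith b ((c ∷ x) ∷ L) with b ≟ c
  ... | yes _ = x ∷ tailsWith b L
  ... | no _ = tailsWith b L

  length-tailsWith : ∀ L → length L ≡ length (tailsWith true L) + length (tailsWith false L)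
  length-tailsWith [] = refl
  length-tailsWith ((true ∷ x) ∷ L) = cong suc (length-tailsWith L)
  length-tailsWith ((false ∷ x) ∷ L) = trans (cong suc (length-tailsWith L)) (sym (+-suc _ _))

  All-tailsWith : ∀ {P : Subset (suc n) → Set} b {L} → All P L → All (λ x → P (b ∷ x)) (tailsWith b L)
  All-tailsWith b [] = []
  All-tailsWith b {(c ∷ x) ∷ L} (px ∷ pL) with b ≟ c
  ... | yes refl = px ∷ All-tailsWith b pL
  ... | no _ = All-tailsWith b pL

  Unique-tailsWith : ∀ b {L} → Unique L → Unique (tailsWith b L)
  Unique-tailsWith b [] = []
  Unique-tailsWith b {(c ∷ x) ∷ L} (x∉L ∷ u) with b ≟ c
  ... | yes refl = All.map (λ ≢bx x≡ → ≢bx (cong (b ∷_) x≡)) (All-tailsWith b x∉L) ∷ Unique-tailsWith b u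
  ... | no _ = Unique-tailsWith b u

uniform-length≤C : ∀ n r {L : List (Subset n)} → Unique L → All (λ A → ∣ A ∣ ≡ r) L → length L ≤ n C r
uniform-length≤C zero r {[]} _ _ = z≤n
uniform-length≤C zero (suc r) {[] ∷ _} _ (() ∷ _)
uniform-length≤C zero zero {[] ∷ []} _ _ = ≤-refl
uniform-length≤C zero zero {[] ∷ [] ∷ _} ((≢[] ∷ _) ∷ _) _ = ⊥-elim (≢[] refl)
uniform-length≤C (suc n) zero {L} u sizes = begin
  length L                                            ≡⟨ length-tailsWith L ⟩
  length (tailsWith true L) + length (tailsWith false L)
    ≡⟨ cong (λ T → length T + length (tailsWith false L)) (All-unsatisfiable⇒[] (λ ()) (All-tailsWith true sizes)) ⟩
  length (tailsWith false L)                          ≤⟨ uniform-length≤C n 0 (Unique-tailsWith false u) (All-tailsWith false sizes) ⟩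
  n C 0                                               ≡⟨ trans (nC0≡1 n) (sym (nC0≡1 (suc n))) ⟩
  suc n C 0                                           ∎
  where open ≤-Reasoning
uniform-length≤C (suc n) (suc r) {L} u sizes = begin
  length L                                            ≡⟨ length-tailsWith L ⟩
  length (tailsWith true L) + length (tailsWith false L)
    ≤⟨ +-mono-≤ (uniform-length≤C n r (Unique-tailsWith true u) (All.map suc-injective (All-tailsWith true sizes)))
                (uniform-length≤C n (suc r) (Unique-tailsWith false u) (All-tailsWith false sizes)) ⟩
  n C r + n C suc r                                   ≡⟨ nCk+nC[k+1]≡[n+1]C[k+1] n r ⟩
  suc n C suc r                                       ∎
  where open ≤-Reasoning

initialSegment : ∀ n → ℕ → Subset n
initialSegment zero m = []
initialSegment (suc n) zero = false ∷ initialSegment n zero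
initialSegment (suc n) (suc m) = true ∷ initialSegment n m

∈-initialSegment⁻ : ∀ {n m} {x : Fin n} → x ∈ initialSegment n m → toℕ x < m
∈-initialSegment⁻ {suc n} {zero} {suc x} (there x∈) = ⊥-elim (n≮0 (∈-initialSegment⁻ {n} {zero} x∈))
∈-initialSegment⁻ {suc n} {suc m} {zero} here = s≤s z≤n
∈-initialSegment⁻ {suc n} {suc m} {suc x} (there x∈) = s≤s (∈-initialSegment⁻ x∈)

∈-initialSegment⁺ : ∀ {n m} {x : Fin n} → toℕ x < m → x ∈ initialSegment n m
∈-initialSegment⁺ {suc n} {suc m} {zero} _ = here
∈-initialSegment⁺ {suc n} {suc m} {suc x} (s≤s x<m) = there (∈-initialSegment⁺ x<m)

∣initialSegment∣ : ∀ {n m} → m ≤ n → ∣ initialSegment n m ∣ ≡ m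
∣initialSegment∣ {zero} z≤n = refl
∣initialSegment∣ {suc n} z≤n = ∣initialSegment∣ {n} z≤n
∣initialSegment∣ {suc n} (s≤s m≤n) = cong suc (∣initialSegment∣ m≤n)

meeting-length≤binomSum : ∀ n k m {L : List (Subset n)} → Unique L → All (λ A → ∣ A ∣ ≡ k) L →
  All (λ A → Nonempty (A ∩ initialSegment n m)) L → length L ≤ binomSum n (k ∸ 1) m
meeting-length≤binomSum zero k m _ _ meets =
  ≤-trans (≤-reflexive (cong length (All-unsatisfiable⇒[] (λ { (() , _) }) meets))) z≤n
meeting-length≤binomSum (suc n) k zero _ _ meets =
  ≤-trans (≤-reflexive (cong length (All-unsatisfiable⇒[] misses meets))) z≤n
  where
  misses : ∀ {A} → ¬ Nonempty (A ∩ initialSegment (suc n) zero)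
  misses (x , x∈) = n≮0 (∈-initialSegment⁻ (p∩q⊆q _ _ x∈))
meeting-length≤binomSum (suc n) k (suc m) {L} u sizes meets = begin
  length L                                            ≡⟨ length-tailsWith L ⟩
  length (tailsWith true L) + length (tailsWith false L)
    ≤⟨ +-mono-≤ (uniform-length≤C n (k ∸ 1) (Unique-tailsWith true u) (All.map (cong (_∸ 1)) (All-tailsWith true sizes)))
                (meeting-length≤binomSum n k m (Unique-tailsWith false u) (All-tailsWith false sizes)
                  (All.map (λ { (suc x , there x∈) → x , x∈ }) (All-tailsWith false meets))) ⟩
  n C (k ∸ 1) + binomSum n (k ∸ 1) m                  ≡⟨ binomSum-suc n (k ∸ 1) m ⟨
  binomSum (suc n) (k ∸ 1) (suc m)                    ∎
  where open ≤-Reasoning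

empty⊎min : ∀ {n} (p : Subset n) → (∀ x → x ∉ p) ⊎ ∃ λ x → IsMin x p
empty⊎min [] = inj₁ λ ()
empty⊎min (true ∷ p) = inj₂ (zero , here , λ _ _ → z≤n)
empty⊎min (false ∷ p) with empty⊎min p
... | inj₁ p-empty = inj₁ λ { (suc x) (there x∈) → p-empty x x∈ }
... | inj₂ (x , x∈ , x-min) = inj₂ (suc x , there x∈ , λ { (suc y) (there y∈) → s≤s (x-min y y∈) })

x∈p─q⇒x∉q : ∀ {n} {p q : Subset n} {x} → x ∈ p ─ q → x ∉ q
x∈p─q⇒x∉q {p = _ ∷ _} {true ∷ _} {zero} () here
x∈p─q⇒x∉q {p = _ ∷ _} {_ ∷ _} {suc x} (there x∈) (there x∈q) = x∈p─q⇒x∉q x∈ x∈q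

─-empty⇒⊆ : ∀ {n} {p q : Subset n} → (∀ x → x ∉ p ─ q) → p ⊆ q
─-empty⇒⊆ {q = q} p─q-empty {x} x∈p with x ∈? q
... | yes x∈q = x∈q
... | no x∉q = ⊥-elim (p─q-empty x (x∈p∧x∉q⇒x∈p─q x∈p x∉q))

initialSegment-≺ : ∀ {n m} (B : Subset n) → ∣ B ∣ ≡ m → m ≤ n → initialSegment n m ≺ B
initialSegment-≺ {n} {m} B ∣B∣≡m m≤n with empty⊎min (B ─ initialSegment n m)
... | inj₁ B─S-empty = inj₁ (─-empty⇒⊆ B─S-empty)
... | inj₂ (b , b-min@(b∈B─S , _)) with empty⊎min (initialSegment n m ─ B)
...   | inj₂ (a , a-min@(a∈S─B , _)) = inj₂ (a , b , a-min , b-min , <-≤-trans a<m m≤b)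
  where
  a<m : toℕ a < m
  a<m = ∈-initialSegment⁻ (p─q⊆p _ _ a∈S─B)
  m≤b : m ≤ toℕ b
  m≤b = ≮⇒≥ λ b<m → x∈p─q⇒x∉q b∈B─S (∈-initialSegment⁺ b<m)
...   | inj₁ S─B-empty = ⊥-elim (<-irrefl refl (subst₂ _<_ (∣initialSegment∣ m≤n) ∣B∣≡m ∣S∣<∣B∣))
  where
  ∣S∣<∣B∣ : ∣ initialSegment n m ∣ < ∣ B ∣
  ∣S∣<∣B∣ = p⊂q⇒∣p∣<∣q∣ (─-empty⇒⊆ S─B-empty , b , p─q⊆p _ _ b∈B─S , x∈p─q⇒x∉q b∈B─S)

LInitial⇒initialSegment∈ : ∀ {n m} {F : Family n} → LInitial m F → NonemptyFamily F → initialSegment n m ∈ᶠ F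
LInitial⇒initialSegment∈ {n} {m} (uniform , downClosed) (B , B∈F) =
  downClosed B (initialSegment n m) B∈F (∣initialSegment∣ m≤n) (initialSegment-≺ B ∣B∣≡m m≤n)
  where
  ∣B∣≡m : ∣ B ∣ ≡ m
  ∣B∣≡m = All.lookup uniform B∈F
  m≤n : m ≤ n
  m≤n = subst (_≤ n) ∣B∣≡m (∣p∣≤n B)

proposition1 : (t n : ℕ) → 2 ≤ t → (k : Fin t → ℕ) →
    (∀ j → 1 ≤ k j) →
    (∀ (j l : Fin t) → j ≤ꟳ l → k l ≤ k j) →
    (pos0 : 0 < t) → (pos1 : 1 < t) →
    k (fromℕ< pos0) + k (fromℕ< pos1) ≤ n →
    (A : Fin t → Family n) →
    (∀ j → LInitial (k j) (A j)) →
    (∀ j → NonemptyFamily (A j)) →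
    (∀ j l → j ≢ l → CrossIntersecting (A j) (A l)) →
    (i : Fin t) → ∣ A i ∣ᶠ ≥ (n ∸ 1) C (k i ∸ 1) →
    (m : ℕ) → (∃ λ j → j ≢ i × k j ≡ m) → (∀ j → j ≢ i → m ≤ k j) →
    ∣ A i ∣ᶠ ≤ binomSum n (k i ∸ 1) m
proposition1 t n _ k _ _ _ _ _ A initial nonempty cross i _ .(k j) (j , j≢i , refl) _ =
  meeting-length≤binomSum n (k i) (k j) (unique (A i)) (proj₁ (initial i))
    (All.tabulate λ A∈ → cross i j (j≢i ∘ sym) _ _ A∈ segment∈Aj)
  where
  segment∈Aj : initialSegment n (k j) ∈ᶠ A j
  segment∈Aj = LInitial⇒initialSegment∈ {F = A j} (initial j) (nonempty j)
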